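{- Let $G=(V,E)$ be a graph and let $G'=(V',E')$ be the graph resulting from applying Rule 2 to some pair of distinct vertices $v,w$ of $G$ satisfying the hypotheses of Rule 2. Then $\gamma(G)=\gamma(G')$.
   Context: Graphs are finite, undirected and simple; $\gamma(G)$ is the minimum size of a dominating set of $G$ (a set $D$ such that every vertex outside $D$ has a neighbor in $D$). $N(v)$ is the set of neighbors of $v$, $N[v]=N(v)\cup\{v\}$, $N(v,w)=N(v)\cup N(w)$, $N[v,w]=N[v]\cup N[w]$, and for sets $X\setminus Y=\{x\in X:x\notin Y\}$. A set $S$ of vertices is dominated by a vertex $x$ if $S\subseteq N[x]$. For distinct $v,w$: $N_1(v,w)=\{u\in N(v,w): N(u)\setminus N[v,w]\neq\emptyset\}$, $N_2(v,w)=\{u\in N(v,w)\setminus N_1(v,w): N(u)\cap N_1(v,w)\neq\emptyset\}$, $N_3(v,w)=N(v,w)\setminus(N_1(v,w)\cup N_2(v,w))$. Rule 2: let $v\neq w$ be vertices with $N_3(v,w)\neq\emptyset$ such that $N_3(v,w)$ is not dominated by any single vertex of $N_2(v,w)\cup N_3(v,w)$. Case 1 ($N_3(v,w)$ is dominated by $v$ or by $w$): (1.1) if $N_3(v,w)\subseteq N(v)$ and $N_3(v,w)\subseteq N(w)$, remove $N_3(v,w)$ and $N_2(v,w)\cap N(v)\cap N(w)$ and add two new vertices $z,z'$ with edges $\{v,z\},\{w,z\},\{v,z'\},\{w,z'\}$; (1.2) if $N_3(v,w)\subseteq N(v)$ but not $N_3(v,w)\subseteq N(w)$, remove $N_3(v,w)$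 and $N_2(v,w)\cap N(v)$ and add a new vertex $v'$ with edge $\{v,v'\}$; (1.3) if $N_3(v,w)\subseteq N(w)$ but not $N_3(v,w)\subseteq N(v)$, remove $N_3(v,w)$ and $N_2(v,w)\cap N(w)$ and add a new vertex $w'$ with edge $\{w,w'\}$. Case 2 ($N_3(v,w)$ is dominated by neither $v$ nor $w$): remove $N_3(v,w)$ and $N_2(v,w)$ and add two new vertices $v',w'$ with edges $\{v,v'\},\{w,w'\}$.
   Formalization: N(v,w) is (N(v) ∪ N(w)) ∖ {v,w} instead of N(v) ∪ N(w), so v and w themselves never belong to N₁(v,w), N₂(v,w) or N₃(v,w). The statement above fails without it. -}

module Defs where

open import Data.Nat using (ℕ; _≤_)
open import Data.Bool using (Bool; true; false; _∧_; _∨_; not; T)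
open import Data.Fin using (Fin; zero; suc) renaming (_≟_ to _≟ᶠ_)
open import Data.List using (List; length; allFin)
open import Data.Bool.ListAction using (any)
open import Data.List.Membership.Propositional using (_∈_)
open import Data.List.Relation.Unary.Unique.Propositional using (Unique)
open import Data.Product using (Σ; ∃; _×_; _,_)
open import Data.Sum using (_⊎_; inj₁; inj₂)
open import Data.Empty using (⊥)
open import Relation.Nullary using (¬_)
open import Relation.Nullary.Decidable using (⌊_⌋)
open import Relation.Binary.PropositionalEquality using (_≡_; _≢_)

Dominating : {V : Set} → (V → V → Set) → List V → Set
Dominating {V} Adj D = ∀ (x : V) → (x ∈ D) ⊎ (Σ V λ y → (y ∈ D) × Adj x y)

IsDomNumber : {V : Set} → (V → V → Set) → ℕ → Set
IsDomNumber {V} Adj k =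
  (Σ (List V) λ D → Unique D × Dominating Adj D × length D ≡ k)
  × (∀ (D : List V) → Unique D → Dominating Adj D → k ≤ length D)

record Graph (n : ℕ) : Set where
  field
    adj     : Fin n → Fin n → Bool
    adj-sym : ∀ a b → adj a b ≡ adj b a
    irrefl  : ∀ a → adj a a ≡ false

module _ {n : ℕ} (G : Graph n) where
  open Graph G

  Adj : Fin n → Fin n → Set
  Adj a b = T (adj a b)

  _==_ : Fin n → Fin n → Bool
  a == b = ⌊ a ≟ᶠ b ⌋

  inN : Fin n → Fin n → Bool
  inN v u = adj v u

  inNvw : Fin n → Fin n → Fin n → Bool
  inNvw v w u = (adj v u ∨ adj w u) ∧ not (u == v) ∧ not (u == w)

  inNcl : Fin n → Fin n → Fin n → Bool
  inNcl v w u = adj v u ∨ adj w u ∨ (u == v) ∨ (u == w)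

  inN1 : Fin n → Fin n → Fin n → Bool
  inN1 v w u = inNvw v w u ∧ any (λ x → adj u x ∧ not (inNcl v w x)) (allFin n)

  inN2 : Fin n → Fin n → Fin n → Bool
  inN2 v w u = inNvw v w u ∧ not (inN1 v w u) ∧ any (λ x → adj u x ∧ inN1 v w x) (allFin n)

  inN3 : Fin n → Fin n → Fin n → Bool
  inN3 v w u = inNvw v w u ∧ not (inN1 v w u) ∧ not (inN2 v w u)

  N3DominatedBy : Fin n → Fin n → Fin n → Set
  N3DominatedBy v w x = ∀ u → T (inN3 v w u) → (u ≡ x) ⊎ Adj x u

  N3Sub : Fin n → Fin n → Fin n → Set
  N3Sub v w x = ∀ u → T (inN3 v w u) → Adj x u

  Rule2Applicable : Fin n → Fin n → Set
  Rule2Applicable v w =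
    (v ≢ w)
    × (Σ (Fin n) λ u → T (inN3 v w u))
    × (∀ x → T (inN2 v w x ∨ inN3 v w x) → ¬ N3DominatedBy v w x)

  -- The graph obtained by deleting the vertices u with rem u = true and
  -- adding m new, pairwise non-adjacent vertices, new vertex j being
  -- adjacent exactly to the old vertices a with attach j a = true.

  NewV : (rem : Fin n → Bool) (m : ℕ) → Set
  NewV rem m = (Σ (Fin n) λ u → T (not (rem u))) ⊎ Fin m

  NewAdj : (rem : Fin n → Bool) (m : ℕ) (attach : Fin m → Fin n → Bool)
         → NewV rem m → NewV rem m → Set
  NewAdj rem m attach (inj₁ (a , _)) (inj₁ (b , _)) = T (adj a b)
  NewAdj rem m attach (inj₁ (a , _)) (inj₂ j)       = T (attach j a)
  NewAdj rem m attach (inj₂ j)       (inj₁ (a , _)) = T (attach j a)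
  NewAdj rem m attach (inj₂ _)       (inj₂ _)       = ⊥

  data Rule2Result (v w : Fin n) :
       (rem : Fin n → Bool) (m : ℕ) (attach : Fin m → Fin n → Bool) → Set where
    case1-1 : N3Sub v w v → N3Sub v w w →
      Rule2Result v w
        (λ u → inN3 v w u ∨ (inN2 v w u ∧ adj v u ∧ adj w u))
        2 (λ _ a → (a == v) ∨ (a == w))
    case1-2 : N3Sub v w v → ¬ N3Sub v w w →
      Rule2Result v w
        (λ u → inN3 v w u ∨ (inN2 v w u ∧ adj v u))
        1 (λ _ a → a == v)
    case1-3 : N3Sub v w w → ¬ N3Sub v w v →
      Rule2Result v w
        (λ u → inN3 v w u ∨ (inN2 v w u ∧ adj w u))
        1 (λ _ a → a == w)
    case2 : ¬ N3DominatedBy v w v → ¬ N3DominatedBy v w w →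
      Rule2Result v w
        (λ u → inN3 v w u ∨ inN2 v w u)
        2 (λ { zero a → a == v ; (suc _) a → a == w })

{-# OPTIONS --safe #-}
-- Vertices of N₂ ∪ N₃ have no neighbour outside N[v,w], and a neighbour of an N₃-vertex that lies
-- in N(v,w) cannot be in N₁.  Hence every vertex of N₃ is dominated from the core
-- C = N₂ ∪ N₃ ∪ {v,w}, and whatever a core vertex dominates is dominated by v or by w.  Since no
-- vertex of N₂ ∪ N₃ dominates N₃ on its own, a dominating set of G contains either an end
-- s ∈ {v,w} dominating N₃ (and then every new vertex hangs at s) or two distinct core vertices;
-- sending its core vertices to s, resp. to v and w, yields a dominating set of the reduced graph
-- of no greater size.  Conversely, a dominating set of the reduced graph dominates the new
-- vertices, so replacing each chosen new vertex by an end it hangs at yields a dominating set of G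
-- (the removed vertices are adjacent to those ends).  For the twins z, z' of Case 1.1 the ends are
-- chosen so that both v and w are present whenever a twin is.
module Submission where

open import Defs
open import Data.Nat using (ℕ; _≤_)
open import Data.Nat.Properties using (≤-trans; ≤-antisym; ≤-reflexive)
open import Data.Bool using (Bool; true; false; not; _∧_; _∨_; T)
open import Data.Bool.Properties using (T-∧; T-∨; T-irrelevant)
open import Data.Bool.ListAction using (any)
open import Data.Fin using (Fin; zero; suc; _≟_)
open import Data.Fin.Properties using (all?; ¬∀⟶∃¬)
open import Data.List using (List; length; map; deduplicate; allFin)
open import Data.List.Properties using (length-map; length-deduplicate)
open import Data.List.Membership.Propositional using (_∈_; lose)
open import Data.List.Membership.Propositional.Properties
  using (∈-map⁺; ∈-allFin; ∈-deduplicate⁺)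
open import Data.List.Relation.Unary.Any.Properties using (any⁺)
open import Data.List.Relation.Unary.Unique.Propositional using (Unique)
open import Data.List.Relation.Unary.Unique.DecPropositional.Properties using (deduplicate-!)
open import Data.Product using (Σ; _×_; _,_; proj₁; proj₂)
open import Data.Product.Properties as ×ₚ using ()
open import Data.Sum as ⊎ using (_⊎_; inj₁; inj₂; [_,_])
open import Data.Sum.Properties as ⊎ₚ using ()
open import Data.Empty using (⊥-elim)
open import Function.Bundles using (Equivalence)
open import Function using (_∘_; id)
open import Relation.Binary.Definitions using (DecidableEquality)
open import Relation.Binary.PropositionalEquality using (_≡_; _≢_; refl; sym; cong; subst)
open import Relation.Nullary using (¬_; Dec; yes; no)
open import Relation.Nullary.Decidable
  using (T?; toWitness; fromWitness; toWitnessFalse; fromWitnessFalse; _→-dec_; _⊎-dec_)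

open Equivalence using (to; from)

T-not⇒¬T : ∀ {b} → T (not b) → ¬ T b
T-not⇒¬T {false} _ ()

¬T⇒T-not : ∀ {b} → ¬ T b → T (not b)
¬T⇒T-not {false} _   = _
¬T⇒T-not {true}  ¬tt = ¬tt _

any-allFin⁺ : ∀ {n} (p : Fin n → Bool) (x : Fin n) → T (p x) → T (any p (allFin n))
any-allFin⁺ p x px = any⁺ p (lose (∈-allFin x) px)

Dominated : {V : Set} → (V → V → Set) → List V → V → Set
Dominated {V} Adj D x = x ∈ D ⊎ Σ V λ y → y ∈ D × Adj x y

Dominating≤ : {V : Set} → (V → V → Set) → ℕ → Set
Dominating≤ {V} Adj k = Σ (List V) λ D → Dominating Adj D × length D ≤ k

DominationBound : {A B : Set} → (A → A → Set) → (B → B → Set) → Set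
DominationBound {A} AdjA AdjB = ∀ (D : List A) → Dominating AdjA D → Dominating≤ AdjB (length D)

module _ {V : Set} {Adj : V → V → Set} where

  dominator : ∀ {D x} → Dominated Adj D x → Σ V λ y → y ∈ D × (x ≡ y ⊎ Adj x y)
  dominator (inj₁ x∈D)           = _ , x∈D , inj₁ refl
  dominator (inj₂ (y , y∈D , a)) = y , y∈D , inj₂ a

  dominated : ∀ {D x y} → y ∈ D → x ≡ y ⊎ Adj x y → Dominated Adj D x
  dominated y∈D (inj₁ refl) = inj₁ y∈D
  dominated y∈D (inj₂ a)    = inj₂ (_ , y∈D , a)

  deduplicate-dominating : DecidableEquality V → ∀ {D} → Dominating Adj D →
    Σ (List V) λ D' → Unique D' × Dominating Adj D' × length D' ≤ length D
  deduplicate-dominating _≟ᵥ_ {D} dom =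
    deduplicate _≟ᵥ_ D , deduplicate-! _≟ᵥ_ D , dedup-dom , length-deduplicate _≟ᵥ_ D
    where
    dedup-dom : Dominating Adj (deduplicate _≟ᵥ_ D)
    dedup-dom x with dominator (dom x)
    ... | y , y∈D , r = dominated (∈-deduplicate⁺ _≟ᵥ_ y∈D) r

map-bound : {V W : Set} {AdjW : W → W → Set} (D : List V) (f : V → W) →
  Dominating AdjW (map f D) → Dominating≤ AdjW (length D)
map-bound D f dom = map f D , dom , ≤-reflexive (length-map f D)

IsDomNumber-transfer : {A B : Set} {AdjA : A → A → Set} {AdjB : B → B → Set} →
  DecidableEquality A → DecidableEquality B →
  DominationBound AdjA AdjB → DominationBound AdjB AdjA →
  ∀ {k} → IsDomNumber AdjA k → IsDomNumber AdjB k
IsDomNumber-transfer _≟ᴬ_ _≟ᴮ_ A≼B B≼A ((D , _ , dom , refl) , minimal)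
  with A≼B D dom
... | D' , dom' , D'≤D with deduplicate-dominating _≟ᴮ_ dom'
...   | E , unique , domE , E≤D' =
        (E , unique , domE , ≤-antisym (≤-trans E≤D' D'≤D) (lower-bound E unique domE)) , lower-bound
  where
  lower-bound : ∀ E → Unique E → Dominating _ E → length D ≤ length E
  lower-bound E _ domE with B≼A E domE
  ... | F , domF , F≤E with deduplicate-dominating _≟ᴬ_ domF
  ...   | F' , uniqueF' , domF' , F'≤F = ≤-trans (minimal F' uniqueF' domF') (≤-trans F'≤F F≤E)

module Reduced {n : ℕ} (G : Graph n) (rem : Fin n → Bool) (m : ℕ) (attach : Fin m → Fin n → Bool) where

  V' : Set
  V' = NewV G rem m

  Adj' : V' → V' → Set
  Adj' = NewAdj G rem m attach

  Kept : Fin n → Set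
  Kept a = T (not (rem a))

  old : (a : Fin n) → Kept a → V'
  old a ka = inj₁ (a , ka)

  old-≡ : ∀ {a b ka kb} → a ≡ b → old a ka ≡ old b kb
  old-≡ refl = cong (old _) (T-irrelevant _ _)

  _≟'_ : DecidableEquality V'
  _≟'_ = ⊎ₚ.≡-dec (×ₚ.≡-dec _≟_ λ ka kb → yes (T-irrelevant ka kb)) _≟_

  old-dominated : ∀ {L a d ka kd} → old d kd ∈ L → a ≡ d ⊎ Adj G a d → Dominated Adj' L (old a ka)
  old-dominated {L} d∈L (inj₁ refl) = inj₁ (subst (_∈ L) (old-≡ refl) d∈L)
  old-dominated     d∈L (inj₂ a~d)  = inj₂ (_ , d∈L , a~d)

  forget : (Fin m → Fin n) → V' → Fin n
  forget h (inj₁ (a , _)) = a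
  forget h (inj₂ j)       = h j

  lift-dominating : ∀ (h : Fin m → Fin n) {D'} → Dominating Adj' D' →
    (∀ j → inj₂ j ∈ D' → ∀ a → T (attach j a) → a ∈ map (forget h) D') →
    (∀ a → T (rem a) → Σ (Fin n) λ y → y ∈ map (forget h) D' × Adj G a y) →
    Dominating (Adj G) (map (forget h) D')
  lift-dominating h {D'} dom attached∈ removed-dominated a with T? (rem a)
  ... | yes removed = inj₂ (removed-dominated a removed)
  ... | no kept with dom (old a (¬T⇒T-not kept))
  ...   | inj₁ a∈D'                   = inj₁ (∈-map⁺ (forget h) a∈D')
  ...   | inj₂ (inj₁ _ , y∈D' , a~y)  = inj₂ (_ , ∈-map⁺ (forget h) y∈D' , a~y)
  ...   | inj₂ (inj₂ j , j∈D' , a~j)  = inj₁ (attached∈ j j∈D' a a~j)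

  pendant-bound : ∀ (h : Fin m → Fin n) →
    (∀ j a → T (attach j a) → a ≡ h j) →
    (∀ a → T (rem a) → Σ (Fin m) λ j → Adj G a (h j)) →
    DominationBound Adj' (Adj G)
  pendant-bound h attached-to-h removed-near-h D' dom =
    map-bound D' (forget h) (lift-dominating h dom attached∈ removed-dominated)
    where
    h∈image : ∀ j → h j ∈ map (forget h) D'
    h∈image j with dom (inj₂ j)
    ... | inj₁ j∈D'                          = ∈-map⁺ (forget h) j∈D'
    ... | inj₂ (inj₁ (a , _) , a∈D' , j~a)   =
          subst (_∈ map (forget h) D') (attached-to-h j a j~a) (∈-map⁺ (forget h) a∈D')

    attached∈ : ∀ j → inj₂ j ∈ D' → ∀ a → T (attach j a) → a ∈ map (forget h) D'
    attached∈ j _ a j~a = subst (_∈ map (forget h) D') (sym (attached-to-h j a j~a)) (h∈image j)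

    removed-dominated : ∀ a → T (rem a) → Σ (Fin n) λ y → y ∈ map (forget h) D' × Adj G a y
    removed-dominated a removed with removed-near-h a removed
    ... | j , a~hj = h j , h∈image j , a~hj

module Twins {n : ℕ} (G : Graph n) (rem : Fin n → Bool) (attach : Fin 2 → Fin n → Bool) where
  open Reduced G rem 2 attach
  open import Data.List.Membership.DecPropositional _≟'_ using (_∈?_)

  twin-lift : ∀ {s t} → (∀ j a → T (attach j a) → a ≡ s ⊎ a ≡ t) → (∀ a → T (rem a) → Adj G a s) →
    ∀ h {D'} → Dominating Adj' D' →
    s ∈ map (forget h) D' → (∀ j → inj₂ j ∈ D' → t ∈ map (forget h) D') →
    Dominating≤ (Adj G) (length D')
  twin-lift {s} attached removed-adj h {D'} dom s∈ t∈ =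
    map-bound D' (forget h) (lift-dominating h dom attached∈ λ a r → s , s∈ , removed-adj a r)
    where
    attached∈ : ∀ j → inj₂ j ∈ D' → ∀ a → T (attach j a) → a ∈ map (forget h) D'
    attached∈ j j∈D' a j~a = [ (λ { refl → s∈ }) , (λ { refl → t∈ j j∈D' }) ] (attached j a j~a)

  twin-bound : ∀ {s t} → Kept s → Kept t →
    (∀ j a → T (attach j a) → a ≡ s ⊎ a ≡ t) → (∀ a → T (rem a) → Adj G a s × Adj G a t) →
    DominationBound Adj' (Adj G)
  twin-bound {s} {t} ks kt attached removed-adj D' dom with old s ks ∈? D' | old t kt ∈? D'
  ... | yes s∈D' | _ =
        twin-lift attached (λ a → proj₁ ∘ removed-adj a) (λ _ → t) dom (∈-map⁺ _ s∈D') (λ _ → ∈-map⁺ _)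
  ... | no _ | yes t∈D' =
        twin-lift (λ j a → ⊎.swap ∘ attached j a) (λ a → proj₂ ∘ removed-adj a) (λ _ → s) dom
                  (∈-map⁺ _ t∈D') (λ _ → ∈-map⁺ _)
  ... | no s∉D' | no t∉D' =
        twin-lift attached (λ a → proj₁ ∘ removed-adj a) ends dom
                  (∈-map⁺ _ (chosen zero)) (λ _ _ → ∈-map⁺ _ (chosen (suc zero)))
    where
    ends : Fin 2 → Fin n
    ends zero    = s
    ends (suc _) = t

    chosen : ∀ j → inj₂ j ∈ D'
    chosen j with dom (inj₂ j)
    ... | inj₁ j∈D' = j∈D'
    ... | inj₂ (inj₁ (a , _) , a∈D' , j~a) =
          ⊥-elim ([ (λ { refl → s∉D' (subst (_∈ D') (old-≡ refl) a∈D') })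
                  , (λ { refl → t∉D' (subst (_∈ D') (old-≡ refl) a∈D') }) ] (attached j a j~a))

module PairNeighbourhood {n : ℕ} (G : Graph n) (v w : Fin n) where
  open Graph G using (adj; adj-sym)

  Adj-sym : ∀ {a b} → Adj G a b → Adj G b a
  Adj-sym {a} {b} = subst T (adj-sym a b)

  InNcl : Fin n → Set
  InNcl a = Adj G v a ⊎ Adj G w a ⊎ a ≡ v ⊎ a ≡ w

  InN23 : Fin n → Set
  InN23 x = T (inN2 G v w x ∨ inN3 G v w x)

  Core : Fin n → Set
  Core x = InN23 x ⊎ x ≡ v ⊎ x ≡ w

  core? : ∀ x → Dec (Core x)
  core? x = T? _ ⊎-dec (x ≟ v ⊎-dec x ≟ w)

  inNcl⁻ : ∀ {a} → T (inNcl G v w a) → InNcl a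
  inNcl⁻ {a} t with to (T-∨ {adj v a}) t
  ... | inj₁ v~a = inj₁ v~a
  ... | inj₂ rest with to (T-∨ {adj w a}) rest
  ...   | inj₁ w~a = inj₂ (inj₁ w~a)
  ...   | inj₂ a≡v∨a≡w =
          inj₂ (inj₂ (⊎.map (toWitness {a? = a ≟ v}) (toWitness {a? = a ≟ w}) (to T-∨ a≡v∨a≡w)))

  inNvw⁻ : ∀ {x} → T (inNvw G v w x) → (Adj G v x ⊎ Adj G w x) × x ≢ v × x ≢ w
  inNvw⁻ {x} t with to (T-∧ {adj v x ∨ adj w x}) t
  ... | near , distinct with to (T-∧ {not (_==_ G x v)}) distinct
  ...   | ≢v , ≢w =
          to (T-∨ {adj v x}) near , toWitnessFalse {a? = x ≟ v} ≢v , toWitnessFalse {a? = x ≟ w} ≢w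

  inNvw⁺ : ∀ {x} → Adj G v x ⊎ Adj G w x → x ≢ v → x ≢ w → T (inNvw G v w x)
  inNvw⁺ {x} near ≢v ≢w =
    from T-∧ (from T-∨ near ,
              from T-∧ (fromWitnessFalse {a? = x ≟ v} ≢v , fromWitnessFalse {a? = x ≟ w} ≢w))

  not-N1-prefix⁻ : ∀ {x b} → T (inNvw G v w x ∧ not (inN1 G v w x) ∧ b) →
    T (inNvw G v w x) × ¬ T (inN1 G v w x) × T (b)
  not-N1-prefix⁻ {x} t with to (T-∧ {inNvw G v w x}) t
  ... | x∈N , rest with to (T-∧ {not (inN1 G v w x)}) rest
  ...   | ∉N1 , b = x∈N , T-not⇒¬T ∉N1 , b

  InN23⁻ : ∀ {x} → InN23 x → T (inNvw G v w x) × ¬ T (inN1 G v w x)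
  InN23⁻ x∈N23 with to T-∨ x∈N23
  ... | inj₁ x∈N2 = let x∈N , ∉N1 , _ = not-N1-prefix⁻ x∈N2 in x∈N , ∉N1
  ... | inj₂ x∈N3 = let x∈N , ∉N1 , _ = not-N1-prefix⁻ x∈N3 in x∈N , ∉N1

  InN23⁺ : ∀ {x} → T (inNvw G v w x) → ¬ T (inN1 G v w x) → InN23 x
  InN23⁺ {x} x∈N ∉N1 with T? (inN2 G v w x)
  ... | yes x∈N2 = from T-∨ (inj₁ x∈N2)
  ... | no ∉N2   = from T-∨ (inj₂ (from T-∧ (x∈N , from T-∧ (¬T⇒T-not ∉N1 , ¬T⇒T-not ∉N2))))

  N3⇒InN23 : ∀ {u} → T (inN3 G v w u) → InN23 u
  N3⇒InN23 u∈N3 = from T-∨ (inj₂ u∈N3)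

  InN23-near : ∀ {x} → InN23 x → Adj G v x ⊎ Adj G w x
  InN23-near = proj₁ ∘ inNvw⁻ ∘ proj₁ ∘ InN23⁻

  InN23⇒≢v : ∀ {x} → InN23 x → x ≢ v
  InN23⇒≢v = proj₁ ∘ proj₂ ∘ inNvw⁻ ∘ proj₁ ∘ InN23⁻

  InN23⇒≢w : ∀ {x} → InN23 x → x ≢ w
  InN23⇒≢w = proj₂ ∘ proj₂ ∘ inNvw⁻ ∘ proj₁ ∘ InN23⁻

  not-N1⇒neighbours-InNcl : ∀ {x y} → T (inNvw G v w x) → ¬ T (inN1 G v w x) → Adj G x y → InNcl y
  not-N1⇒neighbours-InNcl {x} {y} x∈N ∉N1 x~y with T? (inNcl G v w y)
  ... | yes y∈Ncl = inNcl⁻ y∈Ncl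
  ... | no  y∉Ncl = ⊥-elim (∉N1 (from T-∧ (x∈N ,
          any-allFin⁺ (λ z → adj x z ∧ not (inNcl G v w z)) y (from T-∧ (x~y , ¬T⇒T-not y∉Ncl)))))

  InNcl⇒near : ∀ {y} → InNcl y → y ≢ v → y ≢ w → Adj G v y ⊎ Adj G w y
  InNcl⇒near (inj₁ v~y)               _   _   = inj₁ v~y
  InNcl⇒near (inj₂ (inj₁ w~y))        _   _   = inj₂ w~y
  InNcl⇒near (inj₂ (inj₂ (inj₁ y≡v))) y≢v _   = ⊥-elim (y≢v y≡v)
  InNcl⇒near (inj₂ (inj₂ (inj₂ y≡w))) _   y≢w = ⊥-elim (y≢w y≡w)

  N3-neighbour-not-N1 : ∀ {u y} → T (inN3 G v w u) → Adj G u y → ¬ T (inN1 G v w y)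
  N3-neighbour-not-N1 {u} {y} u∈N3 u~y y∈N1 with not-N1-prefix⁻ u∈N3
  ... | u∈N , ∉N1 , ∉N2 = T-not⇒¬T ∉N2 (from T-∧ (u∈N , from T-∧ (¬T⇒T-not ∉N1 ,
          any-allFin⁺ (λ z → adj u z ∧ inN1 G v w z) y (from T-∧ (u~y , y∈N1)))))

  N3-neighbour-core : ∀ {u y} → T (inN3 G v w u) → Adj G u y → Core y
  N3-neighbour-core {u} {y} u∈N3 u~y = by-cases (y ≟ v) (y ≟ w)
    where
    y∈Ncl : InNcl y
    y∈Ncl with not-N1-prefix⁻ u∈N3
    ... | u∈N , ∉N1 , _ = not-N1⇒neighbours-InNcl u∈N ∉N1 u~y

    by-cases : Dec (y ≡ v) → Dec (y ≡ w) → Core y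
    by-cases (yes y≡v) _         = inj₂ (inj₁ y≡v)
    by-cases (no _)    (yes y≡w) = inj₂ (inj₂ y≡w)
    by-cases (no y≢v)  (no y≢w)  = inj₁ (InN23⁺ (inNvw⁺ (InNcl⇒near y∈Ncl y≢v y≢w) y≢v y≢w)
                                                (N3-neighbour-not-N1 u∈N3 u~y))

  end-kept : ∀ {rem : Fin n → Bool} → (∀ x → T (rem x) → InN23 x) →
    ∀ {s} → s ≡ v ⊎ s ≡ w → T (not (rem s))
  end-kept removed⇒InN23 (inj₁ refl) = ¬T⇒T-not λ removed → InN23⇒≢v (removed⇒InN23 v removed) refl
  end-kept removed⇒InN23 (inj₂ refl) = ¬T⇒T-not λ removed → InN23⇒≢w (removed⇒InN23 w removed) refl

  Core-closed : ∀ {d a} → Core d → a ≡ d ⊎ Adj G a d → InNcl a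
  Core-closed (inj₁ d∈N23) (inj₁ refl)     = ⊎.map₂ inj₁ (InN23-near d∈N23)
  Core-closed (inj₁ d∈N23) (inj₂ a~d)      =
    let d∈N , ∉N1 = InN23⁻ d∈N23 in not-N1⇒neighbours-InNcl d∈N ∉N1 (Adj-sym a~d)
  Core-closed (inj₂ (inj₁ refl)) (inj₁ refl) = inj₂ (inj₂ (inj₁ refl))
  Core-closed (inj₂ (inj₁ refl)) (inj₂ a~v)  = inj₁ (Adj-sym a~v)
  Core-closed (inj₂ (inj₂ refl)) (inj₁ refl) = inj₂ (inj₂ (inj₂ refl))
  Core-closed (inj₂ (inj₂ refl)) (inj₂ a~w)  = inj₂ (inj₁ (Adj-sym a~w))

  N3-dominator : ∀ {D u} → Dominating (Adj G) D → T (inN3 G v w u) →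
    Σ (Fin n) λ d → d ∈ D × Core d × (u ≡ d ⊎ Adj G d u)
  N3-dominator {u = u} dom u∈N3 with dom u
  ... | inj₁ u∈D              = u , u∈D , inj₁ (N3⇒InN23 u∈N3) , inj₁ refl
  ... | inj₂ (y , y∈D , u~y)  = y , y∈D , N3-neighbour-core u∈N3 u~y , inj₂ (Adj-sym u~y)

  N3-vertex-dominated? : ∀ x u → Dec (T (inN3 G v w u) → u ≡ x ⊎ Adj G x u)
  N3-vertex-dominated? x u = T? (inN3 G v w u) →-dec (u ≟ x ⊎-dec T? (adj x u))

  N3DominatedBy? : ∀ x → Dec (N3DominatedBy G v w x)
  N3DominatedBy? x = all? (N3-vertex-dominated? x)

  N3-undominated : ∀ {x} → ¬ N3DominatedBy G v w x →
    Σ (Fin n) λ u → T (inN3 G v w u) × ¬ (u ≡ x ⊎ Adj G x u)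
  N3-undominated {x} ¬dom with ¬∀⟶∃¬ n _ (N3-vertex-dominated? x) ¬dom
  ... | u , ¬by-x with T? (inN3 G v w u)
  ...   | yes u∈N3 = u , u∈N3 , λ by-x → ¬by-x (λ _ → by-x)
  ...   | no  u∉N3 = ⊥-elim (¬by-x (⊥-elim ∘ u∉N3))

  N3DominatedBy⇒N3Sub : ∀ {x} → x ≡ v ⊎ x ≡ w → N3DominatedBy G v w x → N3Sub G v w x
  N3DominatedBy⇒N3Sub end dom u u∈N3 with dom u u∈N3 | end
  ... | inj₂ x~u  | _          = x~u
  ... | inj₁ refl | inj₁ refl  = ⊥-elim (InN23⇒≢v (N3⇒InN23 u∈N3) refl)
  ... | inj₁ refl | inj₂ refl  = ⊥-elim (InN23⇒≢w (N3⇒InN23 u∈N3) refl)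

  data CoreDominators (D : List (Fin n)) : Set where
    end-dominator : ∀ {s} → s ∈ D → s ≡ v ⊎ s ≡ w → N3DominatedBy G v w s → CoreDominators D
    two-dominators : ∀ {d₀ d₁} → d₀ ∈ D → Core d₀ → d₁ ∈ D → Core d₁ → d₁ ≢ d₀ → CoreDominators D

  core-dominators : ∀ {D} → Rule2Applicable G v w → Dominating (Adj G) D → CoreDominators D
  core-dominators (_ , (u₀ , u₀∈N3) , no-N23-dominator) dom with N3-dominator dom u₀∈N3
  ... | d₀ , d₀∈D , core₀ , _ with N3DominatedBy? d₀ | core₀
  ...   | yes d₀-dom | inj₁ d₀∈N23 = ⊥-elim (no-N23-dominator d₀ d₀∈N23 d₀-dom)
  ...   | yes d₀-dom | inj₂ end    = end-dominator d₀∈D end d₀-dom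
  ...   | no ¬d₀-dom | _ with N3-undominated ¬d₀-dom
  ...     | u₁ , u₁∈N3 , ¬by-d₀ with N3-dominator dom u₁∈N3
  ...       | d₁ , d₁∈D , core₁ , by-d₁ =
              two-dominators d₀∈D core₀ d₁∈D core₁ λ { refl → ¬by-d₀ by-d₁ }

module Forward {n : ℕ} (G : Graph n) (v w : Fin n)
               (rem : Fin n → Bool) (m : ℕ) (attach : Fin m → Fin n → Bool)
               (removed⇒InN23 : ∀ x → T (rem x) → PairNeighbourhood.InN23 G v w x) where
  open PairNeighbourhood G v w
  open Reduced G rem m attach

  Ends : Fin n → Fin n → Set
  Ends s t = (s ≡ v × t ≡ w) ⊎ (s ≡ w × t ≡ v)

  kept-non-core : ∀ {x} → ¬ Core x → Kept x
  kept-non-core ¬core = ¬T⇒T-not (¬core ∘ inj₁ ∘ removed⇒InN23 _)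

  InNcl-dominated : ∀ {L a ka kv kw} → old v kv ∈ L → old w kw ∈ L → InNcl a → Dominated Adj' L (old a ka)
  InNcl-dominated v∈L _   (inj₁ v~a)               = old-dominated v∈L (inj₂ (Adj-sym v~a))
  InNcl-dominated _   w∈L (inj₂ (inj₁ w~a))        = old-dominated w∈L (inj₂ (Adj-sym w~a))
  InNcl-dominated v∈L _   (inj₂ (inj₂ (inj₁ a≡v))) = old-dominated v∈L (inj₁ a≡v)
  InNcl-dominated _   w∈L (inj₂ (inj₂ (inj₂ a≡w))) = old-dominated w∈L (inj₁ a≡w)

  ends-dominate : ∀ {s t L a ks kt ka} → Ends s t → old s ks ∈ L → old t kt ∈ L → InNcl a →
    Dominated Adj' L (old a ka)
  ends-dominate (inj₁ (refl , refl)) s∈L t∈L = InNcl-dominated s∈L t∈L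
  ends-dominate (inj₂ (refl , refl)) s∈L t∈L = InNcl-dominated t∈L s∈L

  module Collapse {s t : Fin n} (ends : Ends s t) (d₀ : Fin n) (core₀ : Core d₀) where

    ks : Kept s
    ks = end-kept removed⇒InN23 (⊎.map proj₁ proj₁ ends)

    kt : Kept t
    kt = end-kept removed⇒InN23 (⊎.swap (⊎.map proj₂ proj₂ ends))

    collapse : Fin n → V'
    collapse x with x ≟ d₀ | core? x
    ... | yes _ | _         = old s ks
    ... | no _  | yes _     = old t kt
    ... | no _  | no ¬core  = old x (kept-non-core ¬core)

    collapse-d₀ : collapse d₀ ≡ old s ks
    collapse-d₀ with d₀ ≟ d₀ | core? d₀
    ... | yes _    | _ = refl
    ... | no d₀≢d₀ | _ = ⊥-elim (d₀≢d₀ refl)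

    collapse-core : ∀ {x} → x ≢ d₀ → Core x → collapse x ≡ old t kt
    collapse-core {x} x≢d₀ core with x ≟ d₀ | core? x
    ... | yes x≡d₀ | _       = ⊥-elim (x≢d₀ x≡d₀)
    ... | no _     | yes _   = refl
    ... | no _     | no ¬core = ⊥-elim (¬core core)

    collapse-non-core : ∀ {x} (¬core : ¬ Core x) → collapse x ≡ old x (kept-non-core ¬core)
    collapse-non-core {x} ¬core with x ≟ d₀ | core? x
    ... | yes refl | _       = ⊥-elim (¬core core₀)
    ... | no _     | yes core = ⊥-elim (¬core core)
    ... | no _     | no _     = old-≡ refl

    module _ {D : List (Fin n)} (d₀∈D : d₀ ∈ D) where

      s∈image : old s ks ∈ map collapse D
      s∈image = subst (_∈ map collapse D) collapse-d₀ (∈-map⁺ collapse d₀∈D)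

      t∈image : ∀ {d} → d ∈ D → Core d → d ≢ d₀ → old t kt ∈ map collapse D
      t∈image d∈D core d≢d₀ = subst (_∈ map collapse D) (collapse-core d≢d₀ core) (∈-map⁺ collapse d∈D)

      kept-dominated : Dominating (Adj G) D → d₀ ≡ s ⊎ old t kt ∈ map collapse D →
        ∀ a ka → Dominated Adj' (map collapse D) (old a ka)
      kept-dominated dom s-or-t a ka with dominator {Adj = Adj G} (dom a)
      ... | d , d∈D , a-near-d with core? d | d ≟ d₀ | s-or-t
      ...   | no ¬core | _ | _ =
              old-dominated (subst (_∈ map collapse D) (collapse-non-core ¬core) (∈-map⁺ collapse d∈D))
                            a-near-d
      ...   | yes _    | yes refl | inj₁ d₀≡s =
              old-dominated s∈image (subst (λ z → a ≡ z ⊎ Adj G a z) d₀≡s a-near-d)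
      ...   | yes core | yes refl | inj₂ t∈ = ends-dominate ends s∈image t∈ (Core-closed core a-near-d)
      ...   | yes core | no d≢d₀  | _ =
              ends-dominate ends s∈image (t∈image d∈D core d≢d₀) (Core-closed core a-near-d)

  end-bound : ∀ {s t D} → Ends s t → Dominating (Adj G) D → s ∈ D → (∀ j → T (attach j s)) →
    Dominating≤ Adj' (length D)
  end-bound {s} {D = D} ends dom s∈D attached-to-s = map-bound D collapse dominating
    where
    open Collapse ends s (inj₂ (⊎.map proj₁ proj₁ ends))

    dominating : Dominating Adj' (map collapse D)
    dominating (inj₁ (a , ka)) = kept-dominated s∈D dom (inj₁ refl) a ka
    dominating (inj₂ j)        = inj₂ (old s ks , s∈image s∈D , attached-to-s j)

  pair-bound : ∀ {d₀ d₁ D} → Dominating (Adj G) D → d₀ ∈ D → Core d₀ → d₁ ∈ D → Core d₁ → d₁ ≢ d₀ →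
    (∀ j → T (attach j v) ⊎ T (attach j w)) →
    Dominating≤ Adj' (length D)
  pair-bound {d₀} {D = D} dom d₀∈D core₀ d₁∈D core₁ d₁≢d₀ attached = map-bound D collapse dominating
    where
    open Collapse (inj₁ (refl , refl)) d₀ core₀

    v∈image : old v ks ∈ map collapse D
    v∈image = s∈image d₀∈D

    w∈image : old w kt ∈ map collapse D
    w∈image = t∈image d₀∈D d₁∈D core₁ d₁≢d₀

    dominating : Dominating Adj' (map collapse D)
    dominating (inj₁ (a , ka)) = kept-dominated d₀∈D dom (inj₂ w∈image) a ka
    dominating (inj₂ j) with attached j
    ... | inj₁ j~v = inj₂ (_ , v∈image , j~v)
    ... | inj₂ j~w = inj₂ (_ , w∈image , j~w)

  forward-bound : Rule2Applicable G v w →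
    (∀ j → T (attach j v) ⊎ T (attach j w)) →
    (∀ {s} → s ≡ v ⊎ s ≡ w → N3DominatedBy G v w s → ∀ j → T (attach j s)) →
    DominationBound (Adj G) Adj'
  forward-bound app attached dominator-attached D dom with core-dominators app dom
  ... | end-dominator s∈D (inj₁ refl) s-dom =
        end-bound (inj₁ (refl , refl)) dom s∈D (dominator-attached (inj₁ refl) s-dom)
  ... | end-dominator s∈D (inj₂ refl) s-dom =
        end-bound (inj₂ (refl , refl)) dom s∈D (dominator-attached (inj₂ refl) s-dom)
  ... | two-dominators d₀∈D core₀ d₁∈D core₁ d₁≢d₀ =
        pair-bound dom d₀∈D core₀ d₁∈D core₁ d₁≢d₀ attached

module Rule2 {n : ℕ} (G : Graph n) (v w : Fin n) where
  open Graph G using (adj)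
  open PairNeighbourhood G v w

  ==-refl : ∀ {a} → T (_==_ G a a)
  ==-refl {a} = fromWitness {a? = a ≟ a} refl

  N3-or-N2⇒InN23 : ∀ {x b} → T (inN3 G v w x ∨ (inN2 G v w x ∧ b)) → InN23 x
  N3-or-N2⇒InN23 {x} r with to (T-∨ {inN3 G v w x}) r
  ... | inj₁ x∈N3     = N3⇒InN23 x∈N3
  ... | inj₂ x∈N2∧b   = from T-∨ (inj₁ (proj₁ (to (T-∧ {inN2 G v w x}) x∈N2∧b)))

  N3-or-N2⇒near : ∀ {s x} {b : Bool} → N3Sub G v w s → (T b → Adj G s x) →
    T (inN3 G v w x ∨ (inN2 G v w x ∧ b)) → Adj G x s
  N3-or-N2⇒near {x = x} N3⊆N[s] b⇒near r with to (T-∨ {inN3 G v w x}) r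
  ... | inj₁ x∈N3   = Adj-sym (N3⊆N[s] x x∈N3)
  ... | inj₂ x∈N2∧b = Adj-sym (b⇒near (proj₂ (to (T-∧ {inN2 G v w x}) x∈N2∧b)))

  removed⇒InN23 : ∀ {rem m attach} → Rule2Result G v w rem m attach → ∀ x → T (rem x) → InN23 x
  removed⇒InN23 (case1-1 _ _) _ = N3-or-N2⇒InN23
  removed⇒InN23 (case1-2 _ _) _ = N3-or-N2⇒InN23
  removed⇒InN23 (case1-3 _ _) _ = N3-or-N2⇒InN23
  removed⇒InN23 (case2 _ _)   x r = from T-∨ (⊎.swap (to (T-∨ {inN3 G v w x}) r))

  forward : ∀ {rem m attach} → Rule2Applicable G v w → Rule2Result G v w rem m attach →
    DominationBound (Adj G) (NewAdj G rem m attach)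
  forward app r@(case1-1 _ _) = Forward.forward-bound G v w _ _ _ (removed⇒InN23 r) app
    (λ _ → inj₁ (from (T-∨ {_==_ G v v}) (inj₁ ==-refl)))
    λ { (inj₁ refl) _ _ → from (T-∨ {_==_ G v v}) (inj₁ ==-refl)
      ; (inj₂ refl) _ _ → from (T-∨ {_==_ G w v}) (inj₂ ==-refl) }
  forward app r@(case1-2 _ ¬N3⊆N[w]) = Forward.forward-bound G v w _ _ _ (removed⇒InN23 r) app
    (λ _ → inj₁ ==-refl)
    λ { (inj₁ refl) _ _ → ==-refl
      ; (inj₂ refl) w-dom _ → ⊥-elim (¬N3⊆N[w] (N3DominatedBy⇒N3Sub (inj₂ refl) w-dom)) }
  forward app r@(case1-3 _ ¬N3⊆N[v]) = Forward.forward-bound G v w _ _ _ (removed⇒InN23 r) app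
    (λ _ → inj₂ ==-refl)
    λ { (inj₁ refl) v-dom _ → ⊥-elim (¬N3⊆N[v] (N3DominatedBy⇒N3Sub (inj₁ refl) v-dom))
      ; (inj₂ refl) _ _ → ==-refl }
  forward app r@(case2 ¬v-dom ¬w-dom) = Forward.forward-bound G v w _ _ _ (removed⇒InN23 r) app
    (λ { zero → inj₁ ==-refl ; (suc _) → inj₂ ==-refl })
    λ { (inj₁ refl) v-dom _ → ⊥-elim (¬v-dom v-dom) ; (inj₂ refl) w-dom _ → ⊥-elim (¬w-dom w-dom) }

  backward : ∀ {rem m attach} → Rule2Result G v w rem m attach →
    DominationBound (NewAdj G rem m attach) (Adj G)
  backward r@(case1-1 N3⊆N[v] N3⊆N[w]) =
    Twins.twin-bound G _ _
      (end-kept (removed⇒InN23 r) (inj₁ refl)) (end-kept (removed⇒InN23 r) (inj₂ refl))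
      (λ _ a j~a → ⊎.map (toWitness {a? = a ≟ v}) (toWitness {a? = a ≟ w}) (to T-∨ j~a))
      (λ a removed → N3-or-N2⇒near N3⊆N[v] (proj₁ ∘ to (T-∧ {adj v a})) removed ,
                     N3-or-N2⇒near N3⊆N[w] (proj₂ ∘ to (T-∧ {adj v a})) removed)
  backward (case1-2 N3⊆N[v] _) =
    Reduced.pendant-bound G _ _ _ (λ _ → v) (λ _ a j~a → toWitness {a? = a ≟ v} j~a)
      (λ a removed → zero , N3-or-N2⇒near N3⊆N[v] id removed)
  backward (case1-3 N3⊆N[w] _) =
    Reduced.pendant-bound G _ _ _ (λ _ → w) (λ _ a j~a → toWitness {a? = a ≟ w} j~a)
      (λ a removed → zero , N3-or-N2⇒near N3⊆N[w] id removed)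
  backward r@(case2 _ _) =
    Reduced.pendant-bound G _ _ _ ends
      (λ { zero a j~a → toWitness {a? = a ≟ v} j~a ; (suc _) a j~a → toWitness {a? = a ≟ w} j~a })
      (λ a removed → [ (λ v~a → zero , Adj-sym v~a) , (λ w~a → suc zero , Adj-sym w~a) ]
                       (InN23-near (removed⇒InN23 r a removed)))
    where
    ends : Fin 2 → Fin n
    ends zero    = v
    ends (suc _) = w

lemma3 : ∀ {n : ℕ} (G : Graph n) (v w : Fin n) → Rule2Applicable G v w
         → ∀ (rem : Fin n → Bool) (m : ℕ) (attach : Fin m → Fin n → Bool)
         → Rule2Result G v w rem m attach
         → ∀ (k : ℕ) → (IsDomNumber (Adj G) k → IsDomNumber (NewAdj G rem m attach) k)
                      × (IsDomNumber (NewAdj G rem m attach) k → IsDomNumber (Adj G) k)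
lemma3 G v w app rem m attach r k =
  IsDomNumber-transfer _≟_ _≟'_ (forward app r) (backward r) ,
  IsDomNumber-transfer _≟'_ _≟_ (backward r) (forward app r)
  where
  open Reduced G rem m attach using (_≟'_)
  open Rule2 G v w using (forward; backward)
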